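{- Let $V=\mathbb{F}_2^n$, $n\ge3$, and let $\mathcal{C}_1,\mathcal{C}_2$ be distinct $2$-element cocliques of $\Gamma_1$. Then $\mathcal{C}_1,\mathcal{C}_2$ are parallel cocliques of the first type if and only if there are two distinct totally non-singular lines, each of which meets both $\mathcal{C}_1$ and $\mathcal{C}_2$, and which intersect each other in a point outside $\mathcal{C}_1\cup\mathcal{C}_2$.
   Context: On $W=V\times V^*$ let $Q(x,x^*)=x^*(x)$. A point $\langle w\rangle$ of $\mathrm{PG}(2n-1,2)=\mathrm{PG}(W)$ is singular if $Q(w)=0$ and non-singular otherwise; a line is totally non-singular if all three of its points are non-singular. $\Gamma_1$ is the graph on non-singular points in which distinct $\mathbf{p},\mathbf{q}$ are adjacent iff the third point of $\langle\mathbf{p},\mathbf{q}\rangle$ is non-singular (equivalently, via $f:\langle(x,x^*)\rangle\mapsto(\langle x\rangle,\ker x^*)$, the anti-flags $(p_1,H_1),(p_2,H_2)$ satisfy $p_j\in H_{3-j}$, $p_{3-j}\notin H_j$ for some $j$). A $2$-element coclique is a pair of distinct non-adjacent non-singular points (the third point of the line they span is singular). Two distinct $2$-element cocliques are parallel if the lines they span meet in a singular point $\mathbf{p}$; they are then parallel of the first type if all points of the plane spanned by these two lines other than $\mathbf{p}$ are non-singular, and of the second type if the singular points of that plane form a line. -}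

module Defs where

open import Data.Nat using (ℕ)
open import Data.Bool using (Bool; true; false; _xor_; _∧_)
open import Data.Vec using (Vec; zipWith; foldr; replicate)
open import Data.Product using (_×_; Σ; ∃; _,_)
open import Data.Sum using (_⊎_)
open import Relation.Binary.PropositionalEquality using (_≡_; _≢_)
open import Relation.Nullary using (¬_)
open import Function.Bundles using (_⇔_)

-- V = F₂ⁿ (Bool = F₂, xor = +, ∧ = ·).  V* is identified with F₂ⁿ via the
-- standard pairing x*(x) = Σ xᵢ x*ᵢ.  W = V × V*.
W : ℕ → Set
W n = Vec Bool n × Vec Bool n

_⊕_ : ∀ {n} → W n → W n → W n
(x , x*) ⊕ (y , y*) = zipWith _xor_ x y , zipWith _xor_ x* y*

0W : ∀ {n} → W n
0W {n} = replicate n false , replicate n false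

scal : ∀ {n} → Bool → W n → W n
scal true  w = w
scal false w = 0W

Q : ∀ {n} → W n → Bool
Q (x , x*) = foldr _ _xor_ false (zipWith _∧_ x x*)

-- Points of PG(W) = nonzero vectors of W (over F₂ each 1-space has one nonzero vector).
IsPoint : ∀ {n} → W n → Set
IsPoint w = w ≢ 0W

Singular : ∀ {n} → W n → Set
Singular w = IsPoint w × Q w ≡ false

NonSingular : ∀ {n} → W n → Set
NonSingular w = IsPoint w × Q w ≡ true

record Line (n : ℕ) : Set where
  constructor line
  field
    a b : W n
    a-pt : IsPoint a
    b-pt : IsPoint b
    a≢b : a ≢ b

OnLine : ∀ {n} → W n → Line n → Set
OnLine r (line a b _ _ _) = r ≡ a ⊎ r ≡ b ⊎ r ≡ (a ⊕ b)

SameLine : ∀ {n} → Line n → Line n → Set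
SameLine {n} L M = (r : W n) → OnLine r L ⇔ OnLine r M

TotallyNonSingular : ∀ {n} → Line n → Set
TotallyNonSingular {n} L = (r : W n) → OnLine r L → NonSingular r

Adjacent : ∀ {n} → W n → W n → Set
Adjacent p q = NonSingular p × NonSingular q × p ≢ q × NonSingular (p ⊕ q)

record Coclique2 (n : ℕ) : Set where
  constructor coclique
  field
    p q : W n
    p-ns : NonSingular p
    q-ns : NonSingular q
    p≢q : p ≢ q
    nonadj : ¬ Adjacent p q

InCoclique : ∀ {n} → W n → Coclique2 n → Set
InCoclique r C = r ≡ Coclique2.p C ⊎ r ≡ Coclique2.q C

SameCoclique : ∀ {n} → Coclique2 n → Coclique2 n → Set
SameCoclique {n} C D = (r : W n) → InCoclique r C ⇔ InCoclique r D

spanLine : ∀ {n} → Coclique2 n → Line n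
spanLine (coclique p q (pp , _) (qp , _) p≢q _) = line p q pp qp p≢q

InSpan4 : ∀ {n} → W n → W n → W n → W n → W n → Set
InSpan4 w u₁ u₂ u₃ u₄ =
  Σ Bool λ α → Σ Bool λ β → Σ Bool λ γ → Σ Bool λ δ →
    w ≡ (((scal α u₁ ⊕ scal β u₂) ⊕ scal γ u₃) ⊕ scal δ u₄)

InPlaneOf : ∀ {n} → W n → Coclique2 n → Coclique2 n → Set
InPlaneOf w C D =
  InSpan4 w (Coclique2.p C) (Coclique2.q C) (Coclique2.p D) (Coclique2.q D)

ParallelAt : ∀ {n} → Coclique2 n → Coclique2 n → W n → Set
ParallelAt C D r = OnLine r (spanLine C) × OnLine r (spanLine D) × Singular r

Parallel : ∀ {n} → Coclique2 n → Coclique2 n → Set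
Parallel {n} C D = Σ (W n) λ r → ParallelAt C D r

ParallelFirstType : ∀ {n} → Coclique2 n → Coclique2 n → Set
ParallelFirstType {n} C D =
  Σ (W n) λ r → ParallelAt C D r ×
    ((w : W n) → InPlaneOf w C D → IsPoint w → w ≢ r → NonSingular w)

LineMeetsCoclique : ∀ {n} → Line n → Coclique2 n → Set
LineMeetsCoclique {n} L C = Σ (W n) λ r → OnLine r L × InCoclique r C

{-# OPTIONS --safe #-}
-- Over F₂ the quadratic form Q has vanishing third difference, so Q (a + b + c) is determined by
-- the values of Q at a, b, c, a + b, a + c and b + c.
-- If C₁ = {p₁, q₁} and C₂ = {p₂, q₂} are parallel, their lines meet in the singular point
-- p₁ + q₁ = p₂ + q₂; hence p₁ + p₂ = q₁ + q₂, and ⟨p₁, p₂⟩, ⟨q₁, q₂⟩ are the two transversals.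
-- Conversely, no transversal L passes through a common point z of C₁ and C₂: the other transversal
-- meets C₁, C₂ in y₁, y₂ with y₁ + y₂ = r on L, and Q (z + y₁ + y₂) = 0 by the first remark, so L would
-- contain the singular point z + r. Hence the transversals meet C₁ in distinct points x₁, y₁ and C₂
-- in distinct points x₂, y₂, with x₁ + x₂ = r = y₁ + y₂. Then R = x₁ + y₁ = x₂ + y₂ is the singular
-- meet of the two coclique lines, and by the first remark Q is non-zero on the rest of the plane
-- ⟨x₁, x₂, R⟩.
module Submission where

open import Defs
open import Data.Nat using (ℕ; _≤_)
open import Data.Bool using (Bool; true; false; _xor_; _∧_; _≟_)
open import Data.Bool.Properties
  using (xor-comm; xor-assoc; xor-identityˡ; xor-identityʳ; xor-same; not-¬; ¬-not; xor-∧-commutativeRing)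
open import Data.Vec using (Vec; []; _∷_; zipWith; replicate)
import Data.Vec.Properties as Vec
import Data.Product.Properties as Product
open import Data.Product using (_×_; Σ; _,_; proj₁; proj₂)
open import Data.Sum using (_⊎_; inj₁; inj₂; [_,_]; swap; map₂; assocʳ)
open import Data.Maybe using (nothing)
open import Data.Empty using (⊥-elim)
open import Function using (_∘_)
open import Function.Bundles using (_⇔_; mk⇔; Equivalence)
import Function.Properties.Equivalence as ⇔
open import Relation.Nullary using (¬_; yes; no)
open import Relation.Binary.Definitions using (DecidableEquality)
open import Relation.Binary.PropositionalEquality
  using (_≡_; _≢_; refl; sym; trans; cong; cong₂; subst; module ≡-Reasoning)
open import Tactic.RingSolver using (solve-∀)
open import Tactic.RingSolver.Core.AlmostCommutativeRing using (AlmostCommutativeRing; fromCommutativeRing)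

private variable
  n : ℕ
  a b c d u v w x y z r x₁ x₂ y₁ y₂ : W n

⊕-comm : (u v : W n) → (u ⊕ v) ≡ (v ⊕ u)
⊕-comm (x , x*) (y , y*) = cong₂ _,_ (Vec.zipWith-comm xor-comm x y) (Vec.zipWith-comm xor-comm x* y*)

⊕-assoc : (u v w : W n) → ((u ⊕ v) ⊕ w) ≡ (u ⊕ (v ⊕ w))
⊕-assoc (x , x*) (y , y*) (z , z*) =
  cong₂ _,_ (Vec.zipWith-assoc xor-assoc x y z) (Vec.zipWith-assoc xor-assoc x* y* z*)

⊕-identityˡ : (u : W n) → (0W ⊕ u) ≡ u
⊕-identityˡ (x , x*) =
  cong₂ _,_ (Vec.zipWith-identityˡ xor-identityˡ x) (Vec.zipWith-identityˡ xor-identityˡ x*)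

⊕-identityʳ : (u : W n) → (u ⊕ 0W) ≡ u
⊕-identityʳ (x , x*) =
  cong₂ _,_ (Vec.zipWith-identityʳ xor-identityʳ x) (Vec.zipWith-identityʳ xor-identityʳ x*)

⊕-same : (u : W n) → (u ⊕ u) ≡ 0W
⊕-same (x , x*) = cong₂ _,_ (same x) (same x*)
  where
  same : ∀ {m} (xs : Vec Bool m) → zipWith _xor_ xs xs ≡ replicate m false
  same [] = refl
  same (x ∷ xs) = cong₂ _∷_ (xor-same x) (same xs)

x⊕[x⊕y]≡y : (u v : W n) → (u ⊕ (u ⊕ v)) ≡ v
x⊕[x⊕y]≡y u v = begin
  (u ⊕ (u ⊕ v)) ≡⟨ sym (⊕-assoc u u v) ⟩
  ((u ⊕ u) ⊕ v) ≡⟨ cong (_⊕ v) (⊕-same u) ⟩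
  (0W ⊕ v)      ≡⟨ ⊕-identityˡ v ⟩
  v             ∎
  where open ≡-Reasoning

[x⊕y]⊕y≡x : (u v : W n) → ((u ⊕ v) ⊕ v) ≡ u
[x⊕y]⊕y≡x u v = begin
  ((u ⊕ v) ⊕ v) ≡⟨ ⊕-assoc u v v ⟩
  (u ⊕ (v ⊕ v)) ≡⟨ cong (u ⊕_) (⊕-same v) ⟩
  (u ⊕ 0W)      ≡⟨ ⊕-identityʳ u ⟩
  u             ∎
  where open ≡-Reasoning

⊕-cancelˡ : (u ⊕ v) ≡ (u ⊕ w) → v ≡ w
⊕-cancelˡ {u = u} {v} {w} e = trans (sym (x⊕[x⊕y]≡y u v)) (trans (cong (u ⊕_) e) (x⊕[x⊕y]≡y u w))

⊕-cancelʳ : (v ⊕ u) ≡ (w ⊕ u) → v ≡ w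
⊕-cancelʳ {v = v} {u} {w} e = trans (sym ([x⊕y]⊕y≡x v u)) (trans (cong (_⊕ u) e) ([x⊕y]⊕y≡x w u))

x⊕y≡0⇒x≡y : (u ⊕ v) ≡ 0W → u ≡ v
x⊕y≡0⇒x≡y {v = v} e = ⊕-cancelʳ (trans e (sym (⊕-same v)))

≢⇒⊕-point : u ≢ v → IsPoint (u ⊕ v)
≢⇒⊕-point u≢v = u≢v ∘ x⊕y≡0⇒x≡y

x⊕y≢x : IsPoint v → (u ⊕ v) ≢ u
x⊕y≢x {u = u} v-pt e = v-pt (⊕-cancelˡ (trans e (sym (⊕-identityʳ u))))

x⊕y≢y : IsPoint u → (u ⊕ v) ≢ v
x⊕y≢y {v = v} u-pt e = u-pt (⊕-cancelʳ (trans e (sym (⊕-identityˡ v))))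

⊕-interchange : (a b c d : W n) → ((a ⊕ b) ⊕ (c ⊕ d)) ≡ ((a ⊕ c) ⊕ (b ⊕ d))
⊕-interchange a b c d = begin
  ((a ⊕ b) ⊕ (c ⊕ d)) ≡⟨ ⊕-assoc a b (c ⊕ d) ⟩
  (a ⊕ (b ⊕ (c ⊕ d))) ≡⟨ cong (a ⊕_) (sym (⊕-assoc b c d)) ⟩
  (a ⊕ ((b ⊕ c) ⊕ d)) ≡⟨ cong (λ t → a ⊕ (t ⊕ d)) (⊕-comm b c) ⟩
  (a ⊕ ((c ⊕ b) ⊕ d)) ≡⟨ cong (a ⊕_) (⊕-assoc c b d) ⟩
  (a ⊕ (c ⊕ (b ⊕ d))) ≡⟨ sym (⊕-assoc a c (b ⊕ d)) ⟩
  ((a ⊕ c) ⊕ (b ⊕ d)) ∎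
  where open ≡-Reasoning

x⊕y≡z⊕w⇒x⊕z≡y⊕w : (a ⊕ b) ≡ (c ⊕ d) → (a ⊕ c) ≡ (b ⊕ d)
x⊕y≡z⊕w⇒x⊕z≡y⊕w {a = a} {b} {c} {d} e = x⊕y≡0⇒x≡y (begin
  ((a ⊕ c) ⊕ (b ⊕ d)) ≡⟨ ⊕-interchange a c b d ⟩
  ((a ⊕ b) ⊕ (c ⊕ d)) ≡⟨ cong (_⊕ (c ⊕ d)) e ⟩
  ((c ⊕ d) ⊕ (c ⊕ d)) ≡⟨ ⊕-same (c ⊕ d) ⟩
  0W                  ∎)
  where open ≡-Reasoning

_≟W_ : DecidableEquality (W n)
_≟W_ = Product.≡-dec (Vec.≡-dec _≟_) (Vec.≡-dec _≟_)

xor-∧-almostCommutativeRing : AlmostCommutativeRing _ _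
xor-∧-almostCommutativeRing = fromCommutativeRing xor-∧-commutativeRing (λ _ → nothing)

-- The third difference of a quadratic form vanishes; over F₂ all its signs are +.
Q-⊕⊕ : (a b c : W n) →
  Q ((a ⊕ b) ⊕ c) ≡ (Q (a ⊕ b) xor Q (a ⊕ c) xor Q (b ⊕ c) xor Q a xor Q b xor Q c)
Q-⊕⊕ ([] , []) ([] , []) ([] , []) = refl
Q-⊕⊕ (x ∷ xs , x* ∷ xs*) (y ∷ ys , y* ∷ ys*) (z ∷ zs , z* ∷ zs*) =
  trans (cong (((x xor y) xor z) ∧ ((x* xor y*) xor z*) xor_) (Q-⊕⊕ (xs , xs*) (ys , ys*) (zs , zs*)))
        (regroup x x* y y* z z* _ _ _ _ _ _)
  where
  regroup : ∀ x x* y y* z z* h₁ h₂ h₃ h₄ h₅ h₆ →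
    ((x xor y) xor z) ∧ ((x* xor y*) xor z*) xor (h₁ xor h₂ xor h₃ xor h₄ xor h₅ xor h₆) ≡
    ((x xor y) ∧ (x* xor y*) xor h₁) xor ((x xor z) ∧ (x* xor z*) xor h₂) xor
    ((y xor z) ∧ (y* xor z*) xor h₃) xor (x ∧ x* xor h₄) xor (y ∧ y* xor h₅) xor (z ∧ z* xor h₆)
  regroup = solve-∀ xor-∧-almostCommutativeRing

Q-⊕⊕-values : (a b c : W n) → ∀ {s₁ s₂ s₃ t₁ t₂ t₃} →
  Q (a ⊕ b) ≡ s₁ → Q (a ⊕ c) ≡ s₂ → Q (b ⊕ c) ≡ s₃ → Q a ≡ t₁ → Q b ≡ t₂ → Q c ≡ t₃ →
  Q ((a ⊕ b) ⊕ c) ≡ (s₁ xor s₂ xor s₃ xor t₁ xor t₂ xor t₃)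
Q-⊕⊕-values a b c refl refl refl refl refl refl = Q-⊕⊕ a b c

-- OnLine r L unfolds to r ∈⟨ Line.a L , Line.b L ⟩, so lemmas about _∈⟨_,_⟩ apply to lines directly.
_∈⟨_,_⟩ : W n → W n → W n → Set
w ∈⟨ a , b ⟩ = w ≡ a ⊎ w ≡ b ⊎ w ≡ (a ⊕ b)

one-of-three : w ≡ a ⊎ w ≡ b ⊎ w ≡ c → a ≢ w → b ≢ w → w ≡ c
one-of-three (inj₁ refl)        a≢w _   = ⊥-elim (a≢w refl)
one-of-three (inj₂ (inj₁ refl)) _   b≢w = ⊥-elim (b≢w refl)
one-of-three (inj₂ (inj₂ w≡c))  _   _   = w≡c

∈⟨⟩-third : u ∈⟨ a , b ⟩ → v ∈⟨ a , b ⟩ → w ∈⟨ a , b ⟩ → u ≢ v → u ≢ w → v ≢ w → w ≡ (u ⊕ v)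
∈⟨⟩-third (inj₁ refl)        (inj₁ refl)        _ u≢v _ _ = ⊥-elim (u≢v refl)
∈⟨⟩-third (inj₂ (inj₁ refl)) (inj₂ (inj₁ refl)) _ u≢v _ _ = ⊥-elim (u≢v refl)
∈⟨⟩-third (inj₂ (inj₂ refl)) (inj₂ (inj₂ refl)) _ u≢v _ _ = ⊥-elim (u≢v refl)
∈⟨⟩-third (inj₁ refl) (inj₂ (inj₁ refl)) w∈ab _ a≢w b≢w = one-of-three w∈ab a≢w b≢w
∈⟨⟩-third {a = a} {b} (inj₂ (inj₁ refl)) (inj₁ refl) w∈ab _ b≢w a≢w =
  trans (one-of-three w∈ab a≢w b≢w) (⊕-comm a b)
∈⟨⟩-third {a = a} {b} (inj₁ refl) (inj₂ (inj₂ refl)) w∈ab _ a≢w ab≢w =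
  trans (one-of-three (map₂ swap w∈ab) a≢w ab≢w) (sym (x⊕[x⊕y]≡y a b))
∈⟨⟩-third {a = a} {b} (inj₂ (inj₂ refl)) (inj₁ refl) w∈ab _ ab≢w a≢w =
  trans (one-of-three (map₂ swap w∈ab) a≢w ab≢w) (sym (trans (⊕-comm (a ⊕ b) a) (x⊕[x⊕y]≡y a b)))
∈⟨⟩-third {a = a} {b} (inj₂ (inj₁ refl)) (inj₂ (inj₂ refl)) w∈ab _ b≢w ab≢w =
  trans (one-of-three (assocʳ (swap w∈ab)) b≢w ab≢w) (sym (trans (⊕-comm b (a ⊕ b)) ([x⊕y]⊕y≡x a b)))
∈⟨⟩-third {a = a} {b} (inj₂ (inj₂ refl)) (inj₂ (inj₁ refl)) w∈ab _ ab≢w b≢w =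
  trans (one-of-three (assocʳ (swap w∈ab)) b≢w ab≢w) (sym ([x⊕y]⊕y≡x a b))

∈⟨⟩-⊕ : u ∈⟨ a , b ⟩ → v ∈⟨ a , b ⟩ → u ≢ v → (u ⊕ v) ∈⟨ a , b ⟩
∈⟨⟩-⊕ (inj₁ refl)        (inj₁ refl)        u≢v = ⊥-elim (u≢v refl)
∈⟨⟩-⊕ (inj₂ (inj₁ refl)) (inj₂ (inj₁ refl)) u≢v = ⊥-elim (u≢v refl)
∈⟨⟩-⊕ (inj₂ (inj₂ refl)) (inj₂ (inj₂ refl)) u≢v = ⊥-elim (u≢v refl)
∈⟨⟩-⊕ (inj₁ refl) (inj₂ (inj₁ refl)) _ = inj₂ (inj₂ refl)
∈⟨⟩-⊕ {a = a} {b} (inj₂ (inj₁ refl)) (inj₁ refl) _ = inj₂ (inj₂ (⊕-comm b a))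
∈⟨⟩-⊕ {a = a} {b} (inj₁ refl) (inj₂ (inj₂ refl)) _ = inj₂ (inj₁ (x⊕[x⊕y]≡y a b))
∈⟨⟩-⊕ {a = a} {b} (inj₂ (inj₂ refl)) (inj₁ refl) _ =
  inj₂ (inj₁ (trans (⊕-comm (a ⊕ b) a) (x⊕[x⊕y]≡y a b)))
∈⟨⟩-⊕ {a = a} {b} (inj₂ (inj₁ refl)) (inj₂ (inj₂ refl)) _ =
  inj₁ (trans (⊕-comm b (a ⊕ b)) ([x⊕y]⊕y≡x a b))
∈⟨⟩-⊕ {a = a} {b} (inj₂ (inj₂ refl)) (inj₂ (inj₁ refl)) _ = inj₁ ([x⊕y]⊕y≡x a b)

∈⟨a,b⟩⇒∈⟨u,v⟩ : u ∈⟨ a , b ⟩ → v ∈⟨ a , b ⟩ → u ≢ v → w ∈⟨ a , b ⟩ → w ∈⟨ u , v ⟩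
∈⟨a,b⟩⇒∈⟨u,v⟩ {u = u} {v = v} {w = w} u∈ab v∈ab u≢v w∈ab with u ≟W w | v ≟W w
... | yes u≡w | _       = inj₁ (sym u≡w)
... | no _    | yes v≡w = inj₂ (inj₁ (sym v≡w))
... | no u≢w  | no v≢w  = inj₂ (inj₂ (∈⟨⟩-third u∈ab v∈ab w∈ab u≢v u≢w v≢w))

∈⟨u,v⟩⇒∈⟨a,b⟩ : u ∈⟨ a , b ⟩ → v ∈⟨ a , b ⟩ → u ≢ v → w ∈⟨ u , v ⟩ → w ∈⟨ a , b ⟩
∈⟨u,v⟩⇒∈⟨a,b⟩ u∈ab _    _   (inj₁ refl)        = u∈ab
∈⟨u,v⟩⇒∈⟨a,b⟩ _    v∈ab _   (inj₂ (inj₁ refl)) = v∈ab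
∈⟨u,v⟩⇒∈⟨a,b⟩ u∈ab v∈ab u≢v (inj₂ (inj₂ refl)) = ∈⟨⟩-⊕ u∈ab v∈ab u≢v

sameLine : (L M : Line n) → OnLine u L → OnLine v L → OnLine u M → OnLine v M → u ≢ v → SameLine L M
sameLine _ _ u∈L v∈L u∈M v∈M u≢v w = mk⇔
  (∈⟨u,v⟩⇒∈⟨a,b⟩ u∈M v∈M u≢v ∘ ∈⟨a,b⟩⇒∈⟨u,v⟩ u∈L v∈L u≢v)
  (∈⟨u,v⟩⇒∈⟨a,b⟩ u∈L v∈L u≢v ∘ ∈⟨a,b⟩⇒∈⟨u,v⟩ u∈M v∈M u≢v)

meet-unique : (L M : Line n) → ¬ SameLine L M → OnLine u L → OnLine u M → OnLine v L → OnLine v M → u ≡ v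
meet-unique {u = u} {v = v} L M L≉M u∈L u∈M v∈L v∈M with u ≟W v
... | yes u≡v = u≡v
... | no u≢v  = ⊥-elim (L≉M (sameLine L M u∈L v∈L u∈M v∈M u≢v))

off-meet-≢ : (L M : Line n) → ¬ SameLine L M →
  OnLine r L → OnLine r M → OnLine x L → OnLine y M → x ≢ r → x ≢ y
off-meet-≢ L M L≉M r∈L r∈M x∈L x∈M x≢r refl = x≢r (meet-unique L M L≉M x∈L x∈M r∈L r∈M)

singular-on-line : NonSingular a → NonSingular b → Q w ≡ false → w ∈⟨ a , b ⟩ → w ≡ (a ⊕ b)
singular-on-line (_ , Qa) _        Qw (inj₁ refl)         = ⊥-elim (not-¬ Qa Qw)
singular-on-line _        (_ , Qb) Qw (inj₂ (inj₁ refl))  = ⊥-elim (not-¬ Qb Qw)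
singular-on-line _        _        _  (inj₂ (inj₂ w≡a⊕b)) = w≡a⊕b

totallyNonSingular-line : (L : Line n) → NonSingular (Line.a L) → NonSingular (Line.b L) →
  NonSingular (Line.a L ⊕ Line.b L) → TotallyNonSingular L
totallyNonSingular-line _ a-ns _    _     _ (inj₁ refl)        = a-ns
totallyNonSingular-line _ _    b-ns _     _ (inj₂ (inj₁ refl)) = b-ns
totallyNonSingular-line _ _    _    ab-ns _ (inj₂ (inj₂ refl)) = ab-ns

pair-elim : (P : W n → Set) → P x → P y → w ≡ x ⊎ w ≡ y → P w
pair-elim _ px _  (inj₁ refl) = px
pair-elim _ _  py (inj₂ refl) = py

pair-cover : x ≢ y → x ≡ a ⊎ x ≡ b → y ≡ a ⊎ y ≡ b → w ≡ a ⊎ w ≡ b → w ≡ x ⊎ w ≡ y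
pair-cover x≢y (inj₁ refl) (inj₁ refl) _ = ⊥-elim (x≢y refl)
pair-cover _   (inj₁ refl) (inj₂ refl) w∈ab = w∈ab
pair-cover _   (inj₂ refl) (inj₁ refl) w∈ab = swap w∈ab
pair-cover x≢y (inj₂ refl) (inj₂ refl) _ = ⊥-elim (x≢y refl)

pair-sum : x ≢ y → x ≡ a ⊎ x ≡ b → y ≡ a ⊎ y ≡ b → (x ⊕ y) ≡ (a ⊕ b)
pair-sum x≢y (inj₁ refl) (inj₁ refl) = ⊥-elim (x≢y refl)
pair-sum _   (inj₁ refl) (inj₂ refl) = refl
pair-sum {a = a} {b} _ (inj₂ refl) (inj₁ refl) = ⊕-comm b a
pair-sum x≢y (inj₂ refl) (inj₂ refl) = ⊥-elim (x≢y refl)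

pair-partner : x ≡ a ⊎ x ≡ b → (x ⊕ (a ⊕ b)) ≡ a ⊎ (x ⊕ (a ⊕ b)) ≡ b
pair-partner {a = a} {b} (inj₁ refl) = inj₂ (x⊕[x⊕y]≡y a b)
pair-partner {a = a} {b} (inj₂ refl) = inj₁ (trans (⊕-comm b (a ⊕ b)) ([x⊕y]⊕y≡x a b))

∈∉⇒≢ : (C : Coclique2 n) → InCoclique x C → ¬ InCoclique y C → x ≢ y
∈∉⇒≢ _ x∈C y∉C refl = y∉C x∈C

InCoclique-Q : (C : Coclique2 n) → InCoclique x C → Q x ≡ true
InCoclique-Q (coclique _ _ (_ , Qp) _ _ _) (inj₁ refl) = Qp
InCoclique-Q (coclique _ _ _ (_ , Qq) _ _) (inj₂ refl) = Qq

coclique-singular : (C : Coclique2 n) → Q (Coclique2.p C ⊕ Coclique2.q C) ≡ false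
coclique-singular (coclique _ _ p-ns q-ns p≢q nonadj) =
  ¬-not (λ Q≡true → nonadj (p-ns , q-ns , p≢q , ≢⇒⊕-point p≢q , Q≡true))

coclique-pair-singular : (C : Coclique2 n) → x ≢ y → InCoclique x C → InCoclique y C → Q (x ⊕ y) ≡ false
coclique-pair-singular C x≢y x∈C y∈C = trans (cong Q (pair-sum x≢y x∈C y∈C)) (coclique-singular C)

sameCoclique : (C₁ C₂ : Coclique2 n) → x ≢ y →
  InCoclique x C₁ → InCoclique y C₁ → InCoclique x C₂ → InCoclique y C₂ → SameCoclique C₁ C₂
sameCoclique C₁ C₂ x≢y x∈C₁ y∈C₁ x∈C₂ y∈C₂ w = mk⇔
  (pair-elim (λ t → InCoclique t C₂) x∈C₂ y∈C₂ ∘ pair-cover x≢y x∈C₁ y∈C₁)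
  (pair-elim (λ t → InCoclique t C₁) x∈C₁ y∈C₁ ∘ pair-cover x≢y x∈C₂ y∈C₂)

-- x and its partner x ⊕ (p ⊕ q) would be two common points of C₁ and C₂.
equal-sums⇒disjoint : (C₁ C₂ : Coclique2 n) → ¬ SameCoclique C₁ C₂ →
  (Coclique2.p C₁ ⊕ Coclique2.q C₁) ≡ (Coclique2.p C₂ ⊕ Coclique2.q C₂) →
  InCoclique x C₁ → ¬ InCoclique x C₂
equal-sums⇒disjoint {x = x} C₁ C₂ C₁≉C₂ s₁≡s₂ x∈C₁ x∈C₂ =
  C₁≉C₂ (sameCoclique C₁ C₂ x≢partner x∈C₁ (pair-partner x∈C₁) x∈C₂
    (subst (λ s → InCoclique (x ⊕ s) C₂) (sym s₁≡s₂) (pair-partner x∈C₂)))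
  where
  x≢partner : x ≢ (x ⊕ (Coclique2.p C₁ ⊕ Coclique2.q C₁))
  x≢partner = x⊕y≢x (≢⇒⊕-point (Coclique2.p≢q C₁)) ∘ sym

InSpan3 : W n → W n → W n → W n → Set
InSpan3 w a b c = Σ Bool λ α → Σ Bool λ β → Σ Bool λ γ → w ≡ ((scal α a ⊕ scal β b) ⊕ scal γ c)

scal-xor : (α β : Bool) (u : W n) → scal (α xor β) u ≡ (scal α u ⊕ scal β u)
scal-xor true  true  u = sym (⊕-same u)
scal-xor true  false u = sym (⊕-identityʳ u)
scal-xor false β     u = sym (⊕-identityˡ (scal β u))

InSpan3-0W : InSpan3 0W a b c
InSpan3-0W = false , false , false , sym (trans (⊕-identityʳ (0W ⊕ 0W)) (⊕-identityʳ 0W))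

InSpan3-⊕ : InSpan3 u a b c → InSpan3 v a b c → InSpan3 (u ⊕ v) a b c
InSpan3-⊕ {a = a} {b} {c} (α , β , γ , refl) (α′ , β′ , γ′ , refl) =
  α xor α′ , β xor β′ , γ xor γ′ , sym (begin
  ((scal (α xor α′) a ⊕ scal (β xor β′) b) ⊕ scal (γ xor γ′) c)
    ≡⟨ cong₂ _⊕_ (cong₂ _⊕_ (scal-xor α α′ a) (scal-xor β β′ b)) (scal-xor γ γ′ c) ⟩
  (((αa ⊕ α′a) ⊕ (βb ⊕ β′b)) ⊕ (γc ⊕ γ′c))
    ≡⟨ cong (_⊕ (γc ⊕ γ′c)) (⊕-interchange αa α′a βb β′b) ⟩
  (((αa ⊕ βb) ⊕ (α′a ⊕ β′b)) ⊕ (γc ⊕ γ′c))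
    ≡⟨ ⊕-interchange (αa ⊕ βb) (α′a ⊕ β′b) γc γ′c ⟩
  (((αa ⊕ βb) ⊕ γc) ⊕ ((α′a ⊕ β′b) ⊕ γ′c)) ∎)
  where
  open ≡-Reasoning
  αa = scal α a ; βb = scal β b ; γc = scal γ c
  α′a = scal α′ a ; β′b = scal β′ b ; γ′c = scal γ′ c

InSpan3-scal : (α : Bool) → InSpan3 u a b c → InSpan3 (scal α u) a b c
InSpan3-scal true  u∈S = u∈S
InSpan3-scal false _   = InSpan3-0W

InSpan4⇒InSpan3 : InSpan3 x₁ a b c → InSpan3 y₁ a b c → InSpan3 x₂ a b c → InSpan3 y₂ a b c →
  InSpan4 w x₁ y₁ x₂ y₂ → InSpan3 w a b c
InSpan4⇒InSpan3 x₁∈S y₁∈S x₂∈S y₂∈S (α , β , γ , δ , refl) =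
  InSpan3-⊕ (InSpan3-⊕ (InSpan3-⊕ (InSpan3-scal α x₁∈S) (InSpan3-scal β y₁∈S)) (InSpan3-scal γ x₂∈S))
            (InSpan3-scal δ y₂∈S)

InSpan3-nonSingular : Q a ≡ true → Q b ≡ true → Q c ≡ false →
  Q (a ⊕ b) ≡ true → Q (a ⊕ c) ≡ true → Q (b ⊕ c) ≡ true →
  InSpan3 w a b c → IsPoint w → w ≢ c → NonSingular w
InSpan3-nonSingular _ _ _ _ _ _ (false , false , false , refl) w-pt _ =
  ⊥-elim (w-pt (trans (⊕-identityʳ (0W ⊕ 0W)) (⊕-identityʳ 0W)))
InSpan3-nonSingular {c = c} _ _ _ _ _ _ (false , false , true , refl) _ w≢c =
  ⊥-elim (w≢c (trans (cong (_⊕ c) (⊕-identityʳ 0W)) (⊕-identityˡ c)))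
InSpan3-nonSingular {a = a} Qa _ _ _ _ _ (true , false , false , refl) w-pt _ =
  w-pt , trans (cong Q (trans (⊕-identityʳ (a ⊕ 0W)) (⊕-identityʳ a))) Qa
InSpan3-nonSingular {b = b} _ Qb _ _ _ _ (false , true , false , refl) w-pt _ =
  w-pt , trans (cong Q (trans (⊕-identityʳ (0W ⊕ b)) (⊕-identityˡ b))) Qb
InSpan3-nonSingular {a = a} {b} _ _ _ Qab _ _ (true , true , false , refl) w-pt _ =
  w-pt , trans (cong Q (⊕-identityʳ (a ⊕ b))) Qab
InSpan3-nonSingular {a = a} {c = c} _ _ _ _ Qac _ (true , false , true , refl) w-pt _ =
  w-pt , trans (cong (λ t → Q (t ⊕ c)) (⊕-identityʳ a)) Qac
InSpan3-nonSingular {b = b} {c} _ _ _ _ _ Qbc (false , true , true , refl) w-pt _ =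
  w-pt , trans (cong (λ t → Q (t ⊕ c)) (⊕-identityˡ b)) Qbc
InSpan3-nonSingular {a = a} {b} {c} Qa Qb Qc Qab Qac Qbc (true , true , true , refl) w-pt _ =
  w-pt , Q-⊕⊕-values a b c Qab Qac Qbc Qa Qb Qc

TransversalPair : Coclique2 n → Coclique2 n → Set
TransversalPair {n} C₁ C₂ = Σ (Line n) λ L → Σ (Line n) λ M →
  ¬ SameLine L M × TotallyNonSingular L × TotallyNonSingular M ×
  LineMeetsCoclique L C₁ × LineMeetsCoclique L C₂ ×
  LineMeetsCoclique M C₁ × LineMeetsCoclique M C₂ ×
  Σ (W n) λ r → OnLine r L × OnLine r M × ¬ InCoclique r C₁ × ¬ InCoclique r C₂

parallelFirstType⇒transversalPair : (C₁ C₂ : Coclique2 n) → ¬ SameCoclique C₁ C₂ →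
  ParallelFirstType C₁ C₂ → TransversalPair C₁ C₂
parallelFirstType⇒transversalPair {n}
  C₁@(coclique p₁ q₁ p₁-ns q₁-ns p₁≢q₁ _) C₂@(coclique p₂ q₂ p₂-ns q₂-ns _ _) C₁≉C₂
  (r , (r∈⟨p₁,q₁⟩ , r∈⟨p₂,q₂⟩ , _ , Qr) , plane-ns) =
  L , M , L≉M , L-tns , M-tns ,
  (p₁ , inj₁ refl , inj₁ refl) , (p₂ , inj₂ (inj₁ refl) , inj₁ refl) ,
  (q₁ , inj₁ refl , inj₂ refl) , (q₂ , inj₂ (inj₁ refl) , inj₂ refl) ,
  (p₁ ⊕ p₂) , inj₂ (inj₂ refl) , inj₂ (inj₂ p₁⊕p₂≡q₁⊕q₂) , s∉C₁ , s∉C₂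
  where
  r≡p₁⊕q₁ : r ≡ (p₁ ⊕ q₁)
  r≡p₁⊕q₁ = singular-on-line p₁-ns q₁-ns Qr r∈⟨p₁,q₁⟩
  p₁⊕q₁≡p₂⊕q₂ : (p₁ ⊕ q₁) ≡ (p₂ ⊕ q₂)
  p₁⊕q₁≡p₂⊕q₂ = trans (sym r≡p₁⊕q₁) (singular-on-line p₂-ns q₂-ns Qr r∈⟨p₂,q₂⟩)
  p₁⊕p₂≡q₁⊕q₂ : (p₁ ⊕ p₂) ≡ (q₁ ⊕ q₂)
  p₁⊕p₂≡q₁⊕q₂ = x⊕y≡z⊕w⇒x⊕z≡y⊕w p₁⊕q₁≡p₂⊕q₂
  disjoint : InCoclique x C₁ → ¬ InCoclique x C₂
  disjoint = equal-sums⇒disjoint C₁ C₂ C₁≉C₂ p₁⊕q₁≡p₂⊕q₂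
  L M : Line n
  L = line p₁ p₂ (proj₁ p₁-ns) (proj₁ p₂-ns) (disjoint (inj₁ refl) ∘ inj₁)
  M = line q₁ q₂ (proj₁ q₁-ns) (proj₁ q₂-ns) (disjoint (inj₂ refl) ∘ inj₂)
  s-ns : NonSingular (p₁ ⊕ p₂)
  s-ns = plane-ns (p₁ ⊕ p₂) (true , false , true , false , p₁⊕p₂-coeffs)
    (≢⇒⊕-point (disjoint (inj₁ refl) ∘ inj₁)) s≢r
    where
    s≢r : (p₁ ⊕ p₂) ≢ r
    s≢r s≡r = disjoint (inj₂ refl) (inj₁ (sym (⊕-cancelˡ (trans s≡r r≡p₁⊕q₁))))
    p₁⊕p₂-coeffs : (p₁ ⊕ p₂) ≡ (((p₁ ⊕ 0W) ⊕ p₂) ⊕ 0W)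
    p₁⊕p₂-coeffs = sym (trans (⊕-identityʳ _) (cong (_⊕ p₂) (⊕-identityʳ p₁)))
  L-tns : TotallyNonSingular L
  L-tns = totallyNonSingular-line L p₁-ns p₂-ns s-ns
  M-tns : TotallyNonSingular M
  M-tns = totallyNonSingular-line M q₁-ns q₂-ns (subst NonSingular p₁⊕p₂≡q₁⊕q₂ s-ns)
  p₁∉M : ¬ OnLine p₁ M
  p₁∉M = [ p₁≢q₁ , [ disjoint (inj₁ refl) ∘ inj₂ ,
                      (λ p₁≡s → x⊕y≢x (proj₁ p₂-ns) (trans p₁⊕p₂≡q₁⊕q₂ (sym p₁≡s))) ] ]
  L≉M : ¬ SameLine L M
  L≉M L≈M = p₁∉M (Equivalence.to (L≈M p₁) (inj₁ refl))
  s∉C₁ : ¬ InCoclique (p₁ ⊕ p₂) C₁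
  s∉C₁ = [ x⊕y≢x (proj₁ p₂-ns) , x⊕y≢x (proj₁ q₂-ns) ∘ trans (sym p₁⊕p₂≡q₁⊕q₂) ]
  s∉C₂ : ¬ InCoclique (p₁ ⊕ p₂) C₂
  s∉C₂ = [ x⊕y≢y (proj₁ p₁-ns) , x⊕y≢y (proj₁ q₁-ns) ∘ trans (sym p₁⊕p₂≡q₁⊕q₂) ]

transversal-avoids-C₁∩C₂ : (C₁ C₂ : Coclique2 n) (L M : Line n) → ¬ SameCoclique C₁ C₂ → ¬ SameLine L M →
  TotallyNonSingular L → TotallyNonSingular M →
  OnLine r L → OnLine r M → ¬ InCoclique r C₁ → ¬ InCoclique r C₂ →
  OnLine y₁ M → InCoclique y₁ C₁ → OnLine y₂ M → InCoclique y₂ C₂ →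
  OnLine x L → InCoclique x C₁ → InCoclique y C₂ → x ≢ y
transversal-avoids-C₁∩C₂ {r = r} {y₁ = y₁} {y₂ = y₂} {x = z} C₁ C₂ L M C₁≉C₂ L≉M L-tns M-tns
  r∈L r∈M r∉C₁ r∉C₂ y₁∈M y₁∈C₁ y₂∈M y₂∈C₂ z∈L z∈C₁ z∈C₂ refl = not-¬ Q[z⊕r]≡true Q[z⊕r]≡false
  where
  z≢r : z ≢ r
  z≢r = ∈∉⇒≢ C₁ z∈C₁ r∉C₁
  z≢y₁ : z ≢ y₁
  z≢y₁ = off-meet-≢ L M L≉M r∈L r∈M z∈L y₁∈M z≢r
  z≢y₂ : z ≢ y₂
  z≢y₂ = off-meet-≢ L M L≉M r∈L r∈M z∈L y₂∈M z≢r
  y₁≢y₂ : y₁ ≢ y₂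
  y₁≢y₂ y₁≡y₂ = C₁≉C₂ (sameCoclique C₁ C₂ z≢y₁ z∈C₁ y₁∈C₁ z∈C₂
    (subst (λ t → InCoclique t C₂) (sym y₁≡y₂) y₂∈C₂))
  r≡y₁⊕y₂ : r ≡ (y₁ ⊕ y₂)
  r≡y₁⊕y₂ = ∈⟨⟩-third y₁∈M y₂∈M r∈M y₁≢y₂ (∈∉⇒≢ C₁ y₁∈C₁ r∉C₁) (∈∉⇒≢ C₂ y₂∈C₂ r∉C₂)
  Q[z⊕r]≡true : Q (z ⊕ r) ≡ true
  Q[z⊕r]≡true = proj₂ (L-tns (z ⊕ r) (∈⟨⟩-⊕ z∈L r∈L z≢r))
  Q[y₁⊕y₂]≡true : Q (y₁ ⊕ y₂) ≡ true
  Q[y₁⊕y₂]≡true = subst (λ t → Q t ≡ true) r≡y₁⊕y₂ (proj₂ (M-tns r r∈M))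
  Q[z⊕r]≡false : Q (z ⊕ r) ≡ false
  Q[z⊕r]≡false = begin
    Q (z ⊕ r)         ≡⟨ cong (λ t → Q (z ⊕ t)) r≡y₁⊕y₂ ⟩
    Q (z ⊕ (y₁ ⊕ y₂)) ≡⟨ cong Q (sym (⊕-assoc z y₁ y₂)) ⟩
    Q ((z ⊕ y₁) ⊕ y₂) ≡⟨ Q-⊕⊕-values z y₁ y₂
                           (coclique-pair-singular C₁ z≢y₁ z∈C₁ y₁∈C₁) (coclique-pair-singular C₂ z≢y₂ z∈C₂ y₂∈C₂)
                           Q[y₁⊕y₂]≡true (InCoclique-Q C₁ z∈C₁) (InCoclique-Q C₁ y₁∈C₁) (InCoclique-Q C₂ y₂∈C₂) ⟩
    false             ∎
    where open ≡-Reasoning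

parallelFirstType-of-equal-sums : (C₁ C₂ : Coclique2 n) →
  x₁ ≢ y₁ → InCoclique x₁ C₁ → InCoclique y₁ C₁ → x₂ ≢ y₂ → InCoclique x₂ C₂ → InCoclique y₂ C₂ →
  (x₁ ⊕ y₁) ≡ (x₂ ⊕ y₂) → Q (x₁ ⊕ x₂) ≡ true → ParallelFirstType C₁ C₂
parallelFirstType-of-equal-sums {x₁ = x₁} {y₁ = y₁} {x₂ = x₂} {y₂ = y₂} C₁ C₂
  x₁≢y₁ x₁∈C₁ y₁∈C₁ x₂≢y₂ x₂∈C₂ y₂∈C₂ x₁⊕y₁≡x₂⊕y₂ Q[x₁⊕x₂]≡true =
  R ,
  (inj₂ (inj₂ (pair-sum x₁≢y₁ x₁∈C₁ y₁∈C₁)) ,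
   inj₂ (inj₂ (trans x₁⊕y₁≡x₂⊕y₂ (pair-sum x₂≢y₂ x₂∈C₂ y₂∈C₂))) ,
   ≢⇒⊕-point x₁≢y₁ , coclique-pair-singular C₁ x₁≢y₁ x₁∈C₁ y₁∈C₁) ,
  plane-ns
  where
  R : W _
  R = x₁ ⊕ y₁
  y₁≡x₁⊕R : y₁ ≡ (x₁ ⊕ R)
  y₁≡x₁⊕R = sym (x⊕[x⊕y]≡y x₁ y₁)
  y₂≡x₂⊕R : y₂ ≡ (x₂ ⊕ R)
  y₂≡x₂⊕R = trans (sym (x⊕[x⊕y]≡y x₂ y₂)) (cong (x₂ ⊕_) (sym x₁⊕y₁≡x₂⊕y₂))
  S : W _ → Set
  S w = InSpan3 w x₁ x₂ R
  C₁⊆S : InCoclique w C₁ → S w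
  C₁⊆S = pair-elim S
    (true , false , false , sym (trans (⊕-identityʳ (x₁ ⊕ 0W)) (⊕-identityʳ x₁)))
    (true , false , true , trans y₁≡x₁⊕R (cong (_⊕ R) (sym (⊕-identityʳ x₁))))
    ∘ pair-cover x₁≢y₁ x₁∈C₁ y₁∈C₁
  C₂⊆S : InCoclique w C₂ → S w
  C₂⊆S = pair-elim S
    (false , true , false , sym (trans (⊕-identityʳ (0W ⊕ x₂)) (⊕-identityˡ x₂)))
    (false , true , true , trans y₂≡x₂⊕R (cong (_⊕ R) (sym (⊕-identityˡ x₂))))
    ∘ pair-cover x₂≢y₂ x₂∈C₂ y₂∈C₂
  plane-ns : (w : W _) → InPlaneOf w C₁ C₂ → IsPoint w → w ≢ R → NonSingular w
  plane-ns w w∈plane = InSpan3-nonSingular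
    (InCoclique-Q C₁ x₁∈C₁) (InCoclique-Q C₂ x₂∈C₂) (coclique-pair-singular C₁ x₁≢y₁ x₁∈C₁ y₁∈C₁)
    Q[x₁⊕x₂]≡true
    (subst (λ t → Q t ≡ true) y₁≡x₁⊕R (InCoclique-Q C₁ y₁∈C₁))
    (subst (λ t → Q t ≡ true) y₂≡x₂⊕R (InCoclique-Q C₂ y₂∈C₂))
    (InSpan4⇒InSpan3 (C₁⊆S (inj₁ refl)) (C₁⊆S (inj₂ refl)) (C₂⊆S (inj₁ refl)) (C₂⊆S (inj₂ refl)) w∈plane)

transversalPair⇒parallelFirstType : (C₁ C₂ : Coclique2 n) → ¬ SameCoclique C₁ C₂ →
  TransversalPair C₁ C₂ → ParallelFirstType C₁ C₂
transversalPair⇒parallelFirstType C₁ C₂ C₁≉C₂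
  (L , M , L≉M , L-tns , M-tns , (x₁ , x₁∈L , x₁∈C₁) , (x₂ , x₂∈L , x₂∈C₂) ,
   (y₁ , y₁∈M , y₁∈C₁) , (y₂ , y₂∈M , y₂∈C₂) , (r , r∈L , r∈M , r∉C₁ , r∉C₂)) =
  parallelFirstType-of-equal-sums C₁ C₂ x₁≢y₁ x₁∈C₁ y₁∈C₁ x₂≢y₂ x₂∈C₂ y₂∈C₂
    (x⊕y≡z⊕w⇒x⊕z≡y⊕w (trans (sym r≡x₁⊕x₂) r≡y₁⊕y₂))
    (subst (λ t → Q t ≡ true) r≡x₁⊕x₂ (proj₂ (L-tns r r∈L)))
  where
  M≉L : ¬ SameLine M L
  M≉L M≈L = L≉M (⇔.sym ∘ M≈L)
  x₁≢x₂ : x₁ ≢ x₂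
  x₁≢x₂ = transversal-avoids-C₁∩C₂ C₁ C₂ L M C₁≉C₂ L≉M L-tns M-tns r∈L r∈M r∉C₁ r∉C₂
    y₁∈M y₁∈C₁ y₂∈M y₂∈C₂ x₁∈L x₁∈C₁ x₂∈C₂
  y₁≢y₂ : y₁ ≢ y₂
  y₁≢y₂ = transversal-avoids-C₁∩C₂ C₁ C₂ M L C₁≉C₂ M≉L M-tns L-tns r∈M r∈L r∉C₁ r∉C₂
    x₁∈L x₁∈C₁ x₂∈L x₂∈C₂ y₁∈M y₁∈C₁ y₂∈C₂
  x₁≢r : x₁ ≢ r
  x₁≢r = ∈∉⇒≢ C₁ x₁∈C₁ r∉C₁
  x₂≢r : x₂ ≢ r
  x₂≢r = ∈∉⇒≢ C₂ x₂∈C₂ r∉C₂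
  x₁≢y₁ : x₁ ≢ y₁
  x₁≢y₁ = off-meet-≢ L M L≉M r∈L r∈M x₁∈L y₁∈M x₁≢r
  x₂≢y₂ : x₂ ≢ y₂
  x₂≢y₂ = off-meet-≢ L M L≉M r∈L r∈M x₂∈L y₂∈M x₂≢r
  r≡x₁⊕x₂ : r ≡ (x₁ ⊕ x₂)
  r≡x₁⊕x₂ = ∈⟨⟩-third x₁∈L x₂∈L r∈L x₁≢x₂ x₁≢r x₂≢r
  r≡y₁⊕y₂ : r ≡ (y₁ ⊕ y₂)
  r≡y₁⊕y₂ = ∈⟨⟩-third y₁∈M y₂∈M r∈M y₁≢y₂ (∈∉⇒≢ C₁ y₁∈C₁ r∉C₁) (∈∉⇒≢ C₂ y₂∈C₂ r∉C₂)

lemma5 : (n : ℕ) → 3 ≤ n → (C₁ C₂ : Coclique2 n) → ¬ SameCoclique C₁ C₂ →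
    ParallelFirstType C₁ C₂ ⇔
      (Σ (Line n) λ L → Σ (Line n) λ M →
        ¬ SameLine L M × TotallyNonSingular L × TotallyNonSingular M ×
        LineMeetsCoclique L C₁ × LineMeetsCoclique L C₂ ×
        LineMeetsCoclique M C₁ × LineMeetsCoclique M C₂ ×
        Σ (W n) λ r → OnLine r L × OnLine r M ×
          ¬ InCoclique r C₁ × ¬ InCoclique r C₂)
lemma5 _ _ C₁ C₂ C₁≉C₂ =
  mk⇔ (parallelFirstType⇒transversalPair C₁ C₂ C₁≉C₂) (transversalPair⇒parallelFirstType C₁ C₂ C₁≉C₂)
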